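{- Let $0\leq k\leq 2n-1$ with $k$ even, and let $(w_{i})_{1\leq i\leq l}\in\mathbb{C}^{l}$ be an eigenvector of $\bar D_{k}$ belonging to the eigenvalue $\lambda$. Then \begin{align*} \begin{pmatrix} w_{1}\mathbf{z}_{2n,k}\\ \vdots\\ w_{l-1}\mathbf{z}_{2n,k}\\ w_{l}\mathbf{z}_{n,\frac{k}{2}} \end{pmatrix}\in\mathbb{C}^{2(l-1)n} \end{align*} is an eigenvector of $D$ belonging to $\lambda$.
   Context: Let $l,n$ be positive integers. A square matrix of size $p$ is called cyclic (circulant) if its $(r,s)$ entry depends only on $s-r \bmod p$. For a matrix $X$, $X^{(1)}$ denotes its first row. Let $\zeta_{p}$ be a primitive $p$th root of unity and $\mathbf{z}_{p,k}=(1,\zeta_{p}^{k},\zeta_{p}^{2k},\ldots,\zeta_{p}^{(p-1)k})^{T}$. Let $D=(D^{ij})_{1\leq i,j\leq l}$ be a block matrix where $D^{ij}$ is a $2n\times 2n$ cyclic matrix for $1\leq i,j\leq l-1$, $D^{ll}$ is an $n\times n$ cyclic matrix, and for $1\leq i,j\leq l-1$, $D^{il}=\begin{pmatrix}X_{i}\\ X_{i}\end{pmatrix}$, $D^{lj}=\begin{pmatrix}Y_{j}&Y_{j}\end{pmatrix}$ with $X_{i},Y_{j}$ $n\times n$ cyclic matrices. For $0\leq k\leq 2n-1$ define the $l\times l$ matrix $\bar D_{k}=(d^{(k)}_{ij})_{1\leq i,j\leq l}$: if $k$ is even, $d^{(k)}_{ij}=(D^{ij})^{(1)}\mathbf{z}_{2n,k}$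 for $1\leq j\leq l-1$ and $d^{(k)}_{il}=(D^{il})^{(1)}\mathbf{z}_{n,k/2}$; if $k$ is odd, $d^{(k)}_{ij}=(D^{ij})^{(1)}\mathbf{z}_{2n,k}$ for $1\leq j\leq l-1$ and $d^{(k)}_{il}=0$. -}

module Defs where

open import Level using (_⊔_)
open import Algebra.Bundles using (CommutativeRing)
open import Data.Nat as ℕ using (ℕ; zero; suc)
open import Data.Fin using (Fin; toℕ; splitAt; zero; suc)
open import Data.Sum using (_⊎_; inj₁; inj₂; [_,_]′)
open import Data.Product using (_×_; _,_; ∃)
open import Data.Unit using (⊤; tt)
open import Relation.Nullary using (¬_)
open import Relation.Binary.PropositionalEquality using (_≡_)
open import Function using (id)

-- r mod n for r : Fin (n + n)  (row index of the stacked block (X ; X))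
fold : (n : ℕ) → Fin (n ℕ.+ n) → Fin n
fold n r = [ id , id ]′ (splitAt n r)

-- Index set of D: blocks 1..l-1 (here Fin m, l = suc m) of size 2n, plus the last block of size n.
-- n = suc n'.
Idx : ℕ → ℕ → Set
Idx m n' = (Fin m × Fin (suc n' ℕ.+ suc n')) ⊎ Fin (suc n')

-- Block index set {1,…,l}: inj₁ i for i ≤ l-1, inj₂ tt for the last index l.
BIdx : ℕ → Set
BIdx m = Fin m ⊎ ⊤

module _ {c ℓ} (R : CommutativeRing c ℓ) where
  open CommutativeRing R using (Carrier; _≈_; _+_; _*_; 0#; 1#)

  pow : Carrier → ℕ → Carrier
  pow x zero = 1#
  pow x (suc k) = x * pow x k

  Σ : (p : ℕ) → (Fin p → Carrier) → Carrier
  Σ zero f = 0#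
  Σ (suc p) f = f zero + Σ p (λ i → f (suc i))

  IsPrimitiveRoot : ℕ → Carrier → Set ℓ
  IsPrimitiveRoot p ζ = (pow ζ p ≈ 1#) × (∀ j → 0 ℕ.< j → j ℕ.< p → ¬ (pow ζ j ≈ 1#))

  -- a (suc q) × (suc q) matrix is cyclic: its (r,s) entry depends only on s - r mod (suc q)
  IsCyclic : (q : ℕ) → (Fin (suc q) → Fin (suc q) → Carrier) → Set ℓ
  IsCyclic q M = ∀ r s r' s' →
    (toℕ s ℕ.+ (suc q ℕ.∸ toℕ r)) ℕ.% suc q ≡ (toℕ s' ℕ.+ (suc q ℕ.∸ toℕ r')) ℕ.% suc q →
    M r s ≈ M r' s'

  Matrix : ℕ → ℕ → Set c
  Matrix m n' = Idx m n' → Idx m n' → Carrier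

  IsStructured : (m n' : ℕ) → Matrix m n' → Set (c ⊔ ℓ)
  IsStructured m n' D =
      (∀ i j → IsCyclic (n' ℕ.+ suc n') (λ r s → D (inj₁ (i , r)) (inj₁ (j , s))))
    × IsCyclic n' (λ r s → D (inj₂ r) (inj₂ s))
    × (∀ i → ∃ λ (X : Fin (suc n') → Fin (suc n') → Carrier) → IsCyclic n' X
             × (∀ r s → D (inj₁ (i , r)) (inj₂ s) ≈ X (fold (suc n') r) s))
    × (∀ j → ∃ λ (Y : Fin (suc n') → Fin (suc n') → Carrier) → IsCyclic n' Y
             × (∀ r s → D (inj₂ r) (inj₁ (j , s)) ≈ Y r (fold (suc n') s)))

  ΣIdx : (m n' : ℕ) → (Idx m n' → Carrier) → Carrier
  ΣIdx m n' f = Σ m (λ i → Σ (suc n' ℕ.+ suc n') (λ r → f (inj₁ (i , r)))) + Σ (suc n') (λ s → f (inj₂ s))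

  ΣB : (m : ℕ) → (BIdx m → Carrier) → Carrier
  ΣB m f = Σ m (λ i → f (inj₁ i)) + f (inj₂ tt)

  IsEigenvector : (I : Set) → ((I → Carrier) → Carrier) → (I → I → Carrier) → (I → Carrier) → Carrier → Set ℓ
  IsEigenvector I ΣI A v μ = (∃ λ a → ¬ (v a ≈ 0#)) × (∀ a → ΣI (λ b → A a b * v b) ≈ μ * v a)

  -- z_{2n,k} with ζ_{2n} = ζ, and z_{n,k} with ζ_n = ζ^2
  z2n : Carrier → (n k : ℕ) → Fin (n ℕ.+ n) → Carrier
  z2n ζ n k s = pow ζ (k ℕ.* toℕ s)

  zn : Carrier → (n k : ℕ) → Fin n → Carrier
  zn ζ n k s = pow (pow ζ 2) (k ℕ.* toℕ s)

  Dbar : (m n' : ℕ) → Carrier → ℕ → Matrix m n' → BIdx m → BIdx m → Carrier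
  Dbar m n' ζ k D a b = entry a b
    where
    row0 : BIdx m → Idx m n'
    row0 (inj₁ i) = inj₁ (i , zero)
    row0 (inj₂ _) = inj₂ zero
    lastCol : BIdx m → Carrier
    lastCol a with k ℕ.% 2
    ... | zero = Σ (suc n') (λ s → D (row0 a) (inj₂ s) * zn ζ (suc n') (k ℕ./ 2) s)
    ... | suc _ = 0#
    entry : BIdx m → BIdx m → Carrier
    entry a (inj₁ j) = Σ (suc n' ℕ.+ suc n') (λ s → D (row0 a) (inj₁ (j , s)) * z2n ζ (suc n') k s)
    entry a (inj₂ _) = lastCol a

  lift : (m n' : ℕ) → Carrier → ℕ → (BIdx m → Carrier) → Idx m n' → Carrier
  lift m n' ζ k w (inj₁ (i , r)) = w (inj₁ i) * z2n ζ (suc n') k r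
  lift m n' ζ k w (inj₂ s) = w (inj₂ tt) * zn ζ (suc n') (k ℕ./ 2) s

-- Write k = 2j and χ t = ζ^(k t). Since ζ^(2n) = 1 and k is even, χ(t + n) = χ t, so the
-- vector (χ s)ₛ is an eigenvector of every cyclic matrix of size n or 2n, the eigenvalue being
-- its first row paired with χ. Stacking a cyclic X as (X ; X) repeats rows, which keeps that
-- eigenvalue; placing a cyclic Y side by side as (Y Y) repeats columns, which doubles it. In
-- every case the block D^{ab} sends χ on its columns to (D̄_k)_{ab} · χ on its rows, so the
-- row (a, r) of D applied to the lifted vector is χ r · Σ_b (D̄_k)_{ab} w_b = μ · w_a · χ r.

module Submission where

open import Algebra.Bundles using (CommutativeRing)
import Algebra.Properties.CommutativeSemigroup as CommutativeSemigroupProperties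
import Algebra.Properties.Group as GroupProperties
import Algebra.Properties.Semiring.Exp as SemiringExp
import Algebra.Properties.Semiring.Sum as SemiringSum
open import Data.Fin using (Fin; zero; suc; toℕ; _↑ˡ_; _↑ʳ_; splitAt)
open import Data.Fin.Properties
  using (toℕ-↑ˡ; toℕ-↑ʳ; splitAt-↑ˡ; splitAt-↑ʳ; splitAt⁻¹-↑ˡ; splitAt⁻¹-↑ʳ;
         toℕ-inject₁; toℕ-fromℕ; toℕ-fromℕ<; toℕ-injective; toℕ<n)
open import Data.Nat as ℕ using (ℕ; zero; suc)
import Data.Nat.Properties as ℕ
open import Data.Nat.DivMod using (_%_; _/_; _mod_; m%n<n; [m+n]%n≡m%n; m%n%n≡m%n; m*n%n≡0; m*n/n≡m)
open import Data.Nat.Divisibility using (_∣_; divides)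
open import Data.Nat.Tactic.RingSolver using (solve-∀)
open import Data.Product using (_,_; proj₁)
open import Data.Sum using (inj₁; inj₂; [_,_]′)
open import Data.Unit using (tt)
open import Relation.Nullary using (¬_)
open import Function using (_∘_; id)
open import Relation.Binary.PropositionalEquality as ≡ using (_≡_)

open import Defs

toℕ-mod : ∀ m n .{{_ : ℕ.NonZero n}} → toℕ (m mod n) ≡ m % n
toℕ-mod m n = toℕ-fromℕ< (m%n<n m n)

mod-periodic : ∀ m n .{{_ : ℕ.NonZero n}} → (m ℕ.+ n) mod n ≡ m mod n
mod-periodic m n = toℕ-injective (begin
  toℕ ((m ℕ.+ n) mod n)  ≡⟨ toℕ-mod (m ℕ.+ n) n ⟩
  (m ℕ.+ n) % n         ≡⟨ [m+n]%n≡m%n m n ⟩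
  m % n                 ≡⟨ toℕ-mod m n ⟨
  toℕ (m mod n)         ∎)
  where open ≡.≡-Reasoning

m%n≡[toℕ-mod+n]%n : ∀ m n .{{_ : ℕ.NonZero n}} → m % n ≡ (toℕ (m mod n) ℕ.+ n) % n
m%n≡[toℕ-mod+n]%n m n = begin
  m % n                      ≡⟨ m%n%n≡m%n m n ⟨
  m % n % n                  ≡⟨ [m+n]%n≡m%n (m % n) n ⟨
  (m % n ℕ.+ n) % n          ≡⟨ ≡.cong (λ u → (u ℕ.+ n) % n) (toℕ-mod m n) ⟨
  (toℕ (m mod n) ℕ.+ n) % n  ∎
  where open ≡.≡-Reasoning

m*2*n≡[n+n]*m : ∀ m n → m ℕ.* 2 ℕ.* n ≡ (n ℕ.+ n) ℕ.* m
m*2*n≡[n+n]*m = solve-∀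

2*[m*n]≡m*2*n : ∀ m n → 2 ℕ.* (m ℕ.* n) ≡ m ℕ.* 2 ℕ.* n
2*[m*n]≡m*2*n = solve-∀

m*2/2≡m : ∀ m → m ℕ.* 2 / 2 ≡ m
m*2/2≡m m = m*n/n≡m m 2

m*2%2≡0 : ∀ m → m ℕ.* 2 % 2 ≡ 0
m*2%2≡0 m = m*n%n≡0 m 2

module _ {c ℓ} (R : CommutativeRing c ℓ) where
  open CommutativeRing R hiding (zero)
  open SemiringSum semiring using (sum; sum-cong-≋; *-distribˡ-sum; sum-init-last)
  open SemiringExp semiring using (_^_; ^-homo-*; ^-assocʳ)
  open CommutativeSemigroupProperties *-commutativeSemigroup using (x∙yz≈y∙xz; x∙yz≈y∙zx)
  open GroupProperties +-group using (∙-cancelˡ)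
  open import Relation.Binary.Reasoning.Setoid setoid

  Σ≡sum : ∀ p (f : Fin p → Carrier) → Σ R p f ≡ sum f
  Σ≡sum zero    f = ≡.refl
  Σ≡sum (suc p) f = ≡.cong (f zero +_) (Σ≡sum p (f ∘ suc))

  Σ-cong : ∀ p {f g : Fin p → Carrier} → (∀ i → f i ≈ g i) → Σ R p f ≈ Σ R p g
  Σ-cong p {f} {g} f≈g rewrite Σ≡sum p f | Σ≡sum p g = sum-cong-≋ f≈g

  *-distribˡ-Σ : ∀ p x (f : Fin p → Carrier) → x * Σ R p f ≈ Σ R p (λ i → x * f i)
  *-distribˡ-Σ p x f rewrite Σ≡sum p f | Σ≡sum p (λ i → x * f i) = *-distribˡ-sum x f

  Σ-init-last : ∀ p (F : ℕ → Carrier) → Σ R (suc p) (F ∘ toℕ) ≈ Σ R p (F ∘ toℕ) + F p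
  Σ-init-last p F rewrite Σ≡sum (suc p) (F ∘ toℕ) | Σ≡sum p (F ∘ toℕ) =
    trans (sum-init-last (F ∘ toℕ))
          (+-cong (sum-cong-≋ {p} (λ i → reflexive (≡.cong F (toℕ-inject₁ i))))
                  (reflexive (≡.cong F (toℕ-fromℕ p))))

  Σ-splitAt : ∀ a b (f : Fin (a ℕ.+ b) → Carrier) →
    Σ R (a ℕ.+ b) f ≈ Σ R a (λ i → f (i ↑ˡ b)) + Σ R b (λ i → f (a ↑ʳ i))
  Σ-splitAt zero    b f = sym (+-identityˡ _)
  Σ-splitAt (suc a) b f = trans (+-congˡ (Σ-splitAt a b (f ∘ suc))) (sym (+-assoc _ _ _))

  -- Cancelling F 0 is where additive inverses (a ring, not just a semiring) are needed.
  Σ-rotate₁ : ∀ p (F : ℕ → Carrier) → F p ≈ F 0 →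
    Σ R p (F ∘ suc ∘ toℕ) ≈ Σ R p (F ∘ toℕ)
  Σ-rotate₁ p F Fp≈F0 = ∙-cancelˡ (F 0) _ _ (begin
    Σ R (suc p) (F ∘ toℕ)   ≈⟨ Σ-init-last p F ⟩
    Σ R p (F ∘ toℕ) + F p   ≈⟨ +-congˡ Fp≈F0 ⟩
    Σ R p (F ∘ toℕ) + F 0   ≈⟨ +-comm _ _ ⟩
    F 0 + Σ R p (F ∘ toℕ)   ∎)

  Σ-rotate : ∀ p (F : ℕ → Carrier) → (∀ t → F (t ℕ.+ p) ≈ F t) →
    ∀ d → Σ R p (λ s → F (d ℕ.+ toℕ s)) ≈ Σ R p (F ∘ toℕ)
  Σ-rotate p F F-periodic zero    = refl
  Σ-rotate p F F-periodic (suc d) =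
    trans (Σ-rotate p (F ∘ suc) (F-periodic ∘ suc) d) (Σ-rotate₁ p F (F-periodic 0))

  Σ-fold : ∀ n (f : Fin n → Carrier) → Σ R (n ℕ.+ n) (f ∘ fold n) ≈ Σ R n f + Σ R n f
  Σ-fold n f = trans (Σ-splitAt n n (f ∘ fold n))
    (+-cong (Σ-cong n (λ i → reflexive (≡.cong (f ∘ [ id , id ]′) (splitAt-↑ˡ n i n))))
            (Σ-cong n (λ i → reflexive (≡.cong (f ∘ [ id , id ]′) (splitAt-↑ʳ n n i)))))

  ΣB-cong : ∀ m {f g : BIdx m → Carrier} → (∀ b → f b ≈ g b) → ΣB R m f ≈ ΣB R m g
  ΣB-cong m f≈g = +-cong (Σ-cong m (f≈g ∘ inj₁)) (f≈g (inj₂ tt))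

  *-distribˡ-ΣB : ∀ m x (f : BIdx m → Carrier) → x * ΣB R m f ≈ ΣB R m (λ b → x * f b)
  *-distribˡ-ΣB m x f = trans (distribˡ x _ _) (+-congʳ (*-distribˡ-Σ m x (f ∘ inj₁)))

  pow≡^ : ∀ x n → pow R x n ≡ x ^ n
  pow≡^ x zero    = ≡.refl
  pow≡^ x (suc n) = ≡.cong (x *_) (pow≡^ x n)

  pow-+ : ∀ x a b → pow R x (a ℕ.+ b) ≈ pow R x a * pow R x b
  pow-+ x a b rewrite pow≡^ x (a ℕ.+ b) | pow≡^ x a | pow≡^ x b = ^-homo-* x a b

  pow-* : ∀ x a b → pow R (pow R x a) b ≈ pow R x (a ℕ.* b)
  pow-* x a b rewrite pow≡^ (pow R x a) b | pow≡^ x a | pow≡^ x (a ℕ.* b) = ^-assocʳ x a b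

  pow-multiple : ∀ x p → pow R x p ≈ 1# → ∀ j → pow R x (p ℕ.* j) ≈ 1#
  pow-multiple x p xᵖ≈1 zero    = reflexive (≡.cong (pow R x) (ℕ.*-zeroʳ p))
  pow-multiple x p xᵖ≈1 (suc j) = begin
    pow R x (p ℕ.* suc j)               ≡⟨ ≡.cong (pow R x) (ℕ.*-suc p j) ⟩
    pow R x (p ℕ.+ p ℕ.* j)             ≈⟨ pow-+ x p (p ℕ.* j) ⟩
    pow R x p * pow R x (p ℕ.* j)       ≈⟨ *-cong xᵖ≈1 (pow-multiple x p xᵖ≈1 j) ⟩
    1# * 1#                             ≈⟨ *-identityˡ 1# ⟩
    1#                                  ∎

  module Character (χ : ℕ → Carrier) (χ-0 : χ 0 ≈ 1#)
                   (χ-+ : ∀ a b → χ (a ℕ.+ b) ≈ χ a * χ b) where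

    χ-periodic : ∀ {p} → χ p ≈ 1# → ∀ t → χ (p ℕ.+ t) ≈ χ t
    χ-periodic {p} χp≈1 t = begin
      χ (p ℕ.+ t)  ≈⟨ χ-+ p t ⟩
      χ p * χ t    ≈⟨ *-congʳ χp≈1 ⟩
      1# * χ t     ≈⟨ *-identityˡ (χ t) ⟩
      χ t          ∎

    applyχ : ∀ {a b} → (Fin a → Fin b → Carrier) → Fin a → Carrier
    applyχ {b = b} M r = Σ R b (λ s → M r s * χ (toℕ s))

    record IsχEigenvalue {a b} (M : Fin a → Fin b → Carrier) (c : Carrier) : Set ℓ where
      constructor isχEigenvalue
      field χ-scaled : ∀ r → applyχ M r ≈ χ (toℕ r) * c

    isχEigenvalue-cong : ∀ {a b} {M M′ : Fin a → Fin b → Carrier} {c c′} →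
      (∀ r s → M r s ≈ M′ r s) → c ≈ c′ → IsχEigenvalue M′ c′ → IsχEigenvalue M c
    isχEigenvalue-cong M≈M′ c≈c′ (isχEigenvalue M′χ≈c′χ) = isχEigenvalue λ r →
      trans (Σ-cong _ (λ s → *-congʳ (M≈M′ r s))) (trans (M′χ≈c′χ r) (*-congˡ (sym c≈c′)))

    isχEigenvalue-firstRow : ∀ {a b} {M : Fin (suc a) → Fin b → Carrier} {c} →
      IsχEigenvalue M c → IsχEigenvalue M (applyχ M zero)
    isχEigenvalue-firstRow {M = M} {c} (isχEigenvalue Mχ≈cχ) = isχEigenvalue λ r → begin
      applyχ M r                 ≈⟨ Mχ≈cχ r ⟩
      χ (toℕ r) * c              ≈⟨ *-congˡ (trans (sym (*-identityˡ c)) (*-congʳ (sym χ-0))) ⟩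
      χ (toℕ r) * (χ 0 * c)      ≈⟨ *-congˡ (sym (Mχ≈cχ zero)) ⟩
      χ (toℕ r) * applyχ M zero  ∎

    Σ-χ-shift : ∀ p (G : ℕ → Carrier) → χ p ≈ 1# → (∀ t → G (t ℕ.+ p) ≈ G t) →
      ∀ r d → r ℕ.+ d ≡ p →
      Σ R p (λ s → G (d ℕ.+ toℕ s) * χ (toℕ s)) ≈ χ r * Σ R p (λ s → G (toℕ s) * χ (toℕ s))
    Σ-χ-shift p G χp≈1 G-periodic r d r+d≡p = begin
      Σ R p (λ s → G (d ℕ.+ toℕ s) * χ (toℕ s))
        ≈⟨ Σ-cong p (λ s → trans (*-congˡ (χ-shift (toℕ s))) (x∙yz≈y∙xz _ _ _)) ⟩
      Σ R p (λ s → χ r * H (d ℕ.+ toℕ s))   ≈⟨ *-distribˡ-Σ p (χ r) _ ⟨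
      χ r * Σ R p (λ s → H (d ℕ.+ toℕ s))   ≈⟨ *-congˡ (Σ-rotate p H H-periodic d) ⟩
      χ r * Σ R p (H ∘ toℕ)                  ∎
      where
      H : ℕ → Carrier
      H t = G t * χ t

      H-periodic : ∀ t → H (t ℕ.+ p) ≈ H t
      H-periodic t = *-cong (G-periodic t)
        (trans (reflexive (≡.cong χ (ℕ.+-comm t p))) (χ-periodic χp≈1 t))

      χ-shift : ∀ t → χ t ≈ χ r * χ (d ℕ.+ t)
      χ-shift t = begin
        χ t                    ≈⟨ χ-periodic χp≈1 t ⟨
        χ (p ℕ.+ t)            ≡⟨ ≡.cong (λ u → χ (u ℕ.+ t)) r+d≡p ⟨
        χ (r ℕ.+ d ℕ.+ t)      ≡⟨ ≡.cong χ (ℕ.+-assoc r d t) ⟩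
        χ (r ℕ.+ (d ℕ.+ t))    ≈⟨ χ-+ r (d ℕ.+ t) ⟩
        χ r * χ (d ℕ.+ t)      ∎

    module _ {q} {M : Fin (suc q) → Fin (suc q) → Carrier} (M-cyclic : IsCyclic R q M) where
      private
        p = suc q

      diagonal : ℕ → Carrier
      diagonal t = M zero (t mod p)

      diagonal-periodic : ∀ t → diagonal (t ℕ.+ p) ≡ diagonal t
      diagonal-periodic t = ≡.cong (M zero) (mod-periodic t p)

      cyclic-diagonal : ∀ r s → M r s ≈ diagonal ((p ℕ.∸ toℕ r) ℕ.+ toℕ s)
      cyclic-diagonal r s = M-cyclic r s zero (t mod p)
        (≡.trans (≡.cong (_% p) (ℕ.+-comm (toℕ s) d)) (m%n≡[toℕ-mod+n]%n t p))
        where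
        d = p ℕ.∸ toℕ r
        t = d ℕ.+ toℕ s

      cyclic-firstRow : ∀ s → M zero s ≈ diagonal (toℕ s)
      cyclic-firstRow s = trans (cyclic-diagonal zero s)
        (reflexive (≡.trans (≡.cong diagonal (ℕ.+-comm p (toℕ s))) (diagonal-periodic (toℕ s))))

      isχEigenvalue-cyclic : χ p ≈ 1# → IsχEigenvalue M (applyχ M zero)
      isχEigenvalue-cyclic χp≈1 = isχEigenvalue λ r → let d = p ℕ.∸ toℕ r in begin
        applyχ M r
          ≈⟨ Σ-cong p {g = λ s → diagonal (d ℕ.+ toℕ s) * χ (toℕ s)}
                      (λ s → *-congʳ (cyclic-diagonal r s)) ⟩
        Σ R p (λ s → diagonal (d ℕ.+ toℕ s) * χ (toℕ s))
          ≈⟨ Σ-χ-shift p diagonal χp≈1 (reflexive ∘ diagonal-periodic) (toℕ r) d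
               (ℕ.m+[n∸m]≡n (ℕ.<⇒≤ (toℕ<n r))) ⟩
        χ (toℕ r) * Σ R p (λ s → diagonal (toℕ s) * χ (toℕ s))
          ≈⟨ *-congˡ (Σ-cong p {f = λ s → M zero s * χ (toℕ s)}
                              (λ s → *-congʳ (cyclic-firstRow s))) ⟨
        χ (toℕ r) * applyχ M zero
          ∎

    module _ {n} (χn≈1 : χ n ≈ 1#) where

      χ-fold : ∀ r → χ (toℕ (fold n r)) ≈ χ (toℕ r)
      χ-fold r with splitAt n r in eq
      ... | inj₁ i =
        reflexive (≡.cong χ (≡.trans (≡.sym (toℕ-↑ˡ i n)) (≡.cong toℕ (splitAt⁻¹-↑ˡ eq))))
      ... | inj₂ i = begin
        χ (toℕ i)          ≈⟨ χ-periodic χn≈1 (toℕ i) ⟨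
        χ (n ℕ.+ toℕ i)    ≡⟨ ≡.cong χ (toℕ-↑ʳ n i) ⟨
        χ (toℕ (n ↑ʳ i))   ≡⟨ ≡.cong (χ ∘ toℕ) (splitAt⁻¹-↑ʳ eq) ⟩
        χ (toℕ r)          ∎

      isχEigenvalue-foldRows : ∀ {b} {X : Fin n → Fin b → Carrier} {c} →
        IsχEigenvalue X c → IsχEigenvalue (λ r s → X (fold n r) s) c
      isχEigenvalue-foldRows (isχEigenvalue Xχ≈cχ) = isχEigenvalue λ r →
        trans (Xχ≈cχ (fold n r)) (*-congʳ (χ-fold r))

      isχEigenvalue-foldColumns : ∀ {a} {Y : Fin a → Fin n → Carrier} {c} →
        IsχEigenvalue Y c → IsχEigenvalue (λ r s → Y r (fold n s)) (c + c)
      isχEigenvalue-foldColumns {Y = Y} {c} (isχEigenvalue Yχ≈cχ) = isχEigenvalue λ r → begin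
        Σ R (n ℕ.+ n) (λ s → Y r (fold n s) * χ (toℕ s))
          ≈⟨ Σ-cong (n ℕ.+ n) (λ s → *-congˡ (χ-fold s)) ⟨
        Σ R (n ℕ.+ n) (λ s → Y r (fold n s) * χ (toℕ (fold n s)))
          ≈⟨ Σ-fold n (λ t → Y r t * χ (toℕ t)) ⟩
        applyχ Y r + applyχ Y r        ≈⟨ +-cong (Yχ≈cχ r) (Yχ≈cχ r) ⟩
        χ (toℕ r) * c + χ (toℕ r) * c  ≈⟨ distribˡ (χ (toℕ r)) c c ⟨
        χ (toℕ r) * (c + c)            ∎

    module Blocks (m n' : ℕ) where
      private
        N = suc n'

      size : BIdx m → ℕ
      size (inj₁ _) = N ℕ.+ N
      size (inj₂ _) = N

      idx : (a : BIdx m) → Fin (size a) → Idx m n'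
      idx (inj₁ i) r = inj₁ (i , r)
      idx (inj₂ _) s = inj₂ s

      origin : ∀ a → Fin (size a)
      origin (inj₁ _) = zero
      origin (inj₂ _) = zero

      toℕ-origin : ∀ a → toℕ (origin a) ≡ 0
      toℕ-origin (inj₁ _) = ≡.refl
      toℕ-origin (inj₂ _) = ≡.refl

      block : Matrix R m n' → (a b : BIdx m) → Fin (size a) → Fin (size b) → Carrier
      block D a b r s = D (idx a r) (idx b s)

      structured-isχEigenvalue : χ N ≈ 1# → ∀ D → IsStructured R m n' D →
        ∀ a b → IsχEigenvalue (block D a b) (applyχ (block D a b) (origin a))
      structured-isχEigenvalue χN≈1 _ (D-cyclic , _ , _ , _) (inj₁ i) (inj₁ j) =
        isχEigenvalue-cyclic (D-cyclic i j) (trans (χ-periodic χN≈1 N) χN≈1)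
      structured-isχEigenvalue χN≈1 _ (_ , _ , Xs , _) (inj₁ i) (inj₂ _) =
        let X , X-cyclic , D≈X = Xs i in
        isχEigenvalue-firstRow (isχEigenvalue-cong D≈X refl
          (isχEigenvalue-foldRows χN≈1 (isχEigenvalue-cyclic X-cyclic χN≈1)))
      structured-isχEigenvalue χN≈1 _ (_ , _ , _ , Ys) (inj₂ _) (inj₁ j) =
        let Y , Y-cyclic , D≈Y = Ys j in
        isχEigenvalue-firstRow (isχEigenvalue-cong D≈Y refl
          (isχEigenvalue-foldColumns χN≈1 (isχEigenvalue-cyclic Y-cyclic χN≈1)))
      structured-isχEigenvalue χN≈1 _ (_ , D-cyclic , _ , _) (inj₂ _) (inj₂ _) =
        isχEigenvalue-cyclic D-cyclic χN≈1

      isEigenvector-lift : (D : Matrix R m n') (L : BIdx m → BIdx m → Carrier)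
        {w : BIdx m → Carrier} {μ : Carrier} (v : Idx m n' → Carrier) →
        (∀ a b → IsχEigenvalue (block D a b) (L a b)) →
        (∀ b s → v (idx b s) ≈ w b * χ (toℕ s)) →
        IsEigenvector R (BIdx m) (ΣB R m) L w μ →
        IsEigenvector R (Idx m n') (ΣIdx R m n') D v μ
      isEigenvector-lift D L {w} {μ} v blocks-eigen v≈wχ ((a , wa≉0) , Lw≈μw) =
        (idx a (origin a) , v≉0) ,
        λ { (inj₁ (i , r)) → row (inj₁ i) r ; (inj₂ s) → row (inj₂ tt) s }
        where
        v≉0 : ¬ v (idx a (origin a)) ≈ 0#
        v≉0 v≈0 = wa≉0 (begin
          w a                          ≈⟨ *-identityʳ (w a) ⟨
          w a * 1#                     ≈⟨ *-congˡ (trans (reflexive (≡.cong χ (toℕ-origin a))) χ-0) ⟨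
          w a * χ (toℕ (origin a))     ≈⟨ v≈wχ a (origin a) ⟨
          v (idx a (origin a))         ≈⟨ v≈0 ⟩
          0#                           ∎)

        Σ-block : ∀ a b r →
          Σ R (size b) (λ s → block D a b r s * v (idx b s)) ≈ w b * applyχ (block D a b) r
        Σ-block a b r = trans
          (Σ-cong (size b) (λ s → trans (*-congˡ (v≈wχ b s)) (x∙yz≈y∙xz _ _ _)))
          (sym (*-distribˡ-Σ (size b) (w b) _))

        row : ∀ a r → ΣIdx R m n' (λ y → D (idx a r) y * v y) ≈ μ * v (idx a r)
        row a r = begin
          ΣB R m (λ b → Σ R (size b) (λ s → block D a b r s * v (idx b s)))
            ≈⟨ ΣB-cong m (λ b → Σ-block a b r) ⟩
          ΣB R m (λ b → w b * applyχ (block D a b) r)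
            ≈⟨ ΣB-cong m (λ b → trans (*-congˡ (IsχEigenvalue.χ-scaled (blocks-eigen a b) r))
                                      (x∙yz≈y∙zx (w b) _ _)) ⟩
          ΣB R m (λ b → χ (toℕ r) * (L a b * w b))
            ≈⟨ *-distribˡ-ΣB m (χ (toℕ r)) (λ b → L a b * w b) ⟨
          χ (toℕ r) * ΣB R m (λ b → L a b * w b)
            ≈⟨ *-congˡ (Lw≈μw a) ⟩
          χ (toℕ r) * (μ * w a)
            ≈⟨ x∙yz≈y∙zx _ _ _ ⟩
          μ * (w a * χ (toℕ r))
            ≈⟨ *-congˡ (v≈wχ a r) ⟨
          μ * v (idx a r)
            ∎

  module PowerCharacter (ζ : Carrier) (k : ℕ) where

    χ : ℕ → Carrier
    χ t = pow R ζ (k ℕ.* t)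

    χ-0 : χ 0 ≈ 1#
    χ-0 = reflexive (≡.cong (pow R ζ) (ℕ.*-zeroʳ k))

    χ-+ : ∀ a b → χ (a ℕ.+ b) ≈ χ a * χ b
    χ-+ a b = trans (reflexive (≡.cong (pow R ζ) (ℕ.*-distribˡ-+ k a b))) (pow-+ ζ (k ℕ.* a) (k ℕ.* b))

    open Character χ χ-0 χ-+ public

  module EvenFrequency (ζ : Carrier) (j : ℕ) where
    open PowerCharacter ζ (j ℕ.* 2) public

    χ-period : ∀ n → pow R ζ (n ℕ.+ n) ≈ 1# → χ n ≈ 1#
    χ-period n ζ²ⁿ≈1 =
      trans (reflexive (≡.cong (pow R ζ) (m*2*n≡[n+n]*m j n))) (pow-multiple ζ (n ℕ.+ n) ζ²ⁿ≈1 j)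

    zn≈χ : ∀ n s → zn R ζ n (j ℕ.* 2 / 2) s ≈ χ (toℕ s)
    zn≈χ n s rewrite m*2/2≡m j =
      trans (pow-* ζ 2 (j ℕ.* toℕ s)) (reflexive (≡.cong (pow R ζ) (2*[m*n]≡m*2*n j (toℕ s))))

    module _ (m n' : ℕ) where
      open Blocks m n'

      Dbar≈firstRowSum : ∀ D a b → Dbar R m n' ζ (j ℕ.* 2) D a b ≈ applyχ (block D a b) (origin a)
      Dbar≈firstRowSum D (inj₁ _) (inj₁ _) = refl
      Dbar≈firstRowSum D (inj₂ _) (inj₁ _) = refl
      Dbar≈firstRowSum D (inj₁ i) (inj₂ _) rewrite m*2%2≡0 j =
        Σ-cong (suc n') (λ s → *-congˡ {D (inj₁ (i , zero)) (inj₂ s)} (zn≈χ (suc n') s))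
      Dbar≈firstRowSum D (inj₂ _) (inj₂ _) rewrite m*2%2≡0 j =
        Σ-cong (suc n') (λ s → *-congˡ {D (inj₂ zero) (inj₂ s)} (zn≈χ (suc n') s))

      lift≈wχ : ∀ w b s → lift R m n' ζ (j ℕ.* 2) w (idx b s) ≈ w b * χ (toℕ s)
      lift≈wχ w (inj₁ _) s = refl
      lift≈wχ w (inj₂ _) s = *-congˡ (zn≈χ (suc n') s)

lemma2p6 : ∀ {c ℓ} (R : CommutativeRing c ℓ) (m n' : ℕ)
    (ζ : CommutativeRing.Carrier R) → IsPrimitiveRoot R (suc n' ℕ.+ suc n') ζ →
    (D : Matrix R m n') → IsStructured R m n' D →
    (k : ℕ) → k ℕ.< suc n' ℕ.+ suc n' → 2 ∣ k →
    (w : BIdx m → CommutativeRing.Carrier R) (μ : CommutativeRing.Carrier R) →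
    IsEigenvector R (BIdx m) (ΣB R m) (Dbar R m n' ζ k D) w μ →
    IsEigenvector R (Idx m n') (ΣIdx R m n') D (lift R m n' ζ k w) μ
lemma2p6 R m n' ζ ζ-primitive D D-structured .(j ℕ.* 2) _ (divides j ≡.refl) w μ w-eigen =
  isEigenvector-lift D (Dbar R m n' ζ (j ℕ.* 2) D) (lift R m n' ζ (j ℕ.* 2) w)
    Dbar-blocks (lift≈wχ m n' w) w-eigen
  where
  open CommutativeRing R using (refl)
  open EvenFrequency R ζ j
  open Blocks m n'

  Dbar-blocks : ∀ a b → IsχEigenvalue (block D a b) (Dbar R m n' ζ (j ℕ.* 2) D a b)
  Dbar-blocks a b = isχEigenvalue-cong (λ _ _ → refl) (Dbar≈firstRowSum m n' D a b)
    (structured-isχEigenvalue (χ-period (suc n') (proj₁ ζ-primitive)) D D-structured a b)
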